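{- Let $G=\circ(T_0,T_1,\ldots,T_m)$ be a tiled graph, where for each $i$, $T_i$ is a $(k_i,l_i)$-tile, and let $k\in\mathbb N$. If a $k$-traversing Hamiltonian cycle exists in $G$, then $k\le \min_{ws}(G)=\min\{k_0,k_1,\ldots,k_m\}$.
   Context: A tile is a triple $T=(H,x,y)$ where $H$ is a connected graph and $x=(x_1,\ldots,x_p)$ (the left wall) and $y=(y_1,\ldots,y_q)$ (the right wall) are sequences of distinct vertices of $H$, no vertex of $H$ appearing in both $x$ and $y$; $T$ is called a $(p,q)$-tile. Vertices in $x$ or $y$ are wall vertices; the other vertices of $H$ are internal vertices of $T$. Tiles $(H,x,y)$ and $(H',x',y')$ are compatible if $|y|=|x'|$; their join $(H,x,y)\otimes(H',x',y')$ is the tile $(H'',x,y')$ where $H''$ is obtained from the disjoint union of $H$ and $H'$ by identifying $y_j$ with $x'_j$ for every $j$. A sequence $(T_0,\ldots,T_m)$ is compatible if consecutive tiles are compatible. A tile $(H,x,y)$ with $|x|=|y|$ is cyclically compatible and its cyclization is obtained by identifying $x_j$ with $y_j$ for all $j$. A tiled graph $G=\circ(T_0,\ldots,T_m)$ is the cyclization of the join $T_0\otimes\cdots\otimes T_m$ of a compatible sequence of at least $3$ tiles whose join is cyclically compatible. Each tile's graph is regarded as a subgraph of $G$, and $C\cap T_i$ denotes the intersection of a subgraph $C$ of $G$ with the graph of $T_i$. For a Hamiltonian cycle $C$ of $G$, let $N_i$ be the set of isolated vertices of $C\cap T_i$. $C$ is $k$-traversing if for every $i\in\{0,\ldots,m\}$,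 $(C\cap T_i)\setminus N_i$ consists of $k$ paths, each starting in a vertex of the left wall of $T_i$ and ending in a vertex of the right wall of $T_i$, which together cover all internal vertices of $T_i$. $\min_{ws}(G)$ denotes $\min\{k_0,\ldots,k_m\}$. -}

module Defs where

open import Data.Nat using (ℕ; zero; suc; _≤_; _⊓_)
open import Data.Nat.Properties using (_≟_)
open import Data.Fin using (Fin; zero; suc; fromℕ; inject₁; lower₁; toℕ)
open import Data.Sum using (_⊎_; inj₁; inj₂)
open import Data.Product using (Σ; ∃; ∃-syntax; _×_; _,_)
open import Data.List using (List; []; _∷_; _++_; _∷ʳ_)
open import Data.List.Membership.Propositional using (_∈_)
open import Data.List.Relation.Unary.Unique.Propositional using (Unique)
open import Data.List.Relation.Unary.Linked using (Linked)
open import Relation.Binary.Construct.Closure.ReflexiveTransitive using (Star)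
open import Relation.Binary.PropositionalEquality using (_≡_)
open import Relation.Nullary using (¬_; yes; no)
open import Function.Bundles using (_↔_; Inverse)

prev : ∀ {n} → Fin (suc n) → Fin (suc n)
prev {n} zero = fromℕ n
prev (suc i) = inject₁ i

next : ∀ {n} → Fin (suc n) → Fin (suc n)
next {n} i with n ≟ toℕ i
... | yes _ = zero
... | no ne = lower₁ (suc i) λ eq → ne (Data.Nat.Properties.suc-injective eq)

-- A (p,q)-tile is represented (up to isomorphism) with vertex set
-- Fin p ⊎ (Fin q ⊎ Fin r): the left wall x_j = inj₁ j, the right wall
-- y_j = inj₂ (inj₁ j), and r internal vertices inj₂ (inj₂ v).
-- Walls are thus sequences of distinct vertices, and disjoint.

TV : ℕ → ℕ → ℕ → Set
TV p q r = Fin p ⊎ (Fin q ⊎ Fin r)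

leftW : ∀ {p q r} → Fin p → TV p q r
leftW j = inj₁ j

rightW : ∀ {p q r} → Fin q → TV p q r
rightW j = inj₂ (inj₁ j)

internalV : ∀ {p q r} → Fin r → TV p q r
internalV v = inj₂ (inj₂ v)

record Tile (p q : ℕ) : Set₁ where
  field
    r         : ℕ
    E         : TV p q r → TV p q r → Set
    E-sym     : ∀ {a b} → E a b → E b a
    E-irrefl  : ∀ {a} → ¬ E a a
    connected : ∀ a b → Star E a b

open Tile public

-- Tiled graphs  G = ∘(T_0,…,T_m),  m ≥ 2 (at least 3 tiles).
-- w i is the size of the right wall of T_i, which equals the size of the
-- left wall of T_{i+1 mod (m+1)} (compatibility + cyclic compatibility).
-- So T_i is a (k_i , l_i)-tile with k_i = w (prev i), l_i = w i.

record TiledGraph : Set₁ where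
  field
    m      : ℕ
    m≥2    : 2 ≤ m
    w      : Fin (suc m) → ℕ
    tile   : (i : Fin (suc m)) → Tile (w (prev i)) (w i)

  kk : Fin (suc m) → ℕ
  kk i = w (prev i)

  TVi : Fin (suc m) → Set
  TVi i = TV (w (prev i)) (w i) (r (tile i))

  -- Vertices of the cyclization: for each i, the identified wall
  -- y^{(i)}_j = x^{(i+1)}_j (tagged inj₁ j) and the internal vertices of T_i.
  V : Set
  V = Σ (Fin (suc m)) (λ i → Fin (w i) ⊎ Fin (r (tile i)))

  emb : (i : Fin (suc m)) → TVi i → V
  emb i (inj₁ j)        = prev i , inj₁ j
  emb i (inj₂ (inj₁ j)) = i , inj₁ j
  emb i (inj₂ (inj₂ v)) = i , inj₂ v

  EG : V → V → Set
  EG u v = ∃[ i ] ∃[ a ] ∃[ b ] (E (tile i) a b × emb i a ≡ u × emb i b ≡ v)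

open TiledGraph public

minFin : ∀ m → (Fin (suc m) → ℕ) → ℕ
minFin zero    f = f zero
minFin (suc m) f = f zero ⊓ minFin m (λ i → f (suc i))

minws : TiledGraph → ℕ
minws G = minFin (m G) (kk G)

record HamCycle (G : TiledGraph) : Set₁ where
  field
    n     : ℕ
    n≥2   : 2 ≤ n
    order : Fin (suc n) ↔ V G
    adj   : ∀ t → EG G (Inverse.to order t) (Inverse.to order (next t))

  CE : V G → V G → Set
  CE u v = ∃[ t ] ((Inverse.to order t ≡ u × Inverse.to order (next t) ≡ v)
                 ⊎ (Inverse.to order t ≡ v × Inverse.to order (next t) ≡ u))

open HamCycle public

TileEdge : (G : TiledGraph) → HamCycle G → (i : Fin (suc (m G))) →
           TVi G i → TVi G i → Set
TileEdge G C i a b = E (tile G i) a b × CE C (emb G i a) (emb G i b)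

PathEdge : {A : Set} → List A → A → A → Set
PathEdge P a b = ∃[ xs ] ∃[ ys ] (P ≡ xs ++ (a ∷ b ∷ ys) ⊎ P ≡ xs ++ (b ∷ a ∷ ys))

IsWallPath : ∀ {p q r} → (TV p q r → TV p q r → Set) → List (TV p q r) → Set
IsWallPath {p} {q} {r} R P =
  ∃[ a ] ∃[ b ] ∃[ mid ] (P ≡ leftW a ∷ (mid ∷ʳ rightW b)) × Unique P × Linked R P

-- C is k-traversing: for every i, (C ∩ T_i) minus its isolated vertices
-- is the disjoint union of k paths P_0,…,P_{k-1}, each from the left wall
-- to the right wall of T_i, together covering all internal vertices.
Traversing : (G : TiledGraph) → ℕ → HamCycle G → Set
Traversing G k C = ∀ (i : Fin (suc (m G))) →
  Σ (Fin k → List (TVi G i)) λ P → (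
      (∀ (j : Fin k) → IsWallPath (TileEdge G C i) (P j))
    × (∀ (j j′ : Fin k) v → v ∈ P j → v ∈ P j′ → j ≡ j′)
    × (∀ a b → TileEdge G C i a b → ∃[ j ] PathEdge (P j) a b)
    × (∀ (v : Fin (r (tile G i))) → ∃[ j ] internalV v ∈ P j))

{-# OPTIONS --safe #-}
-- Each of the k vertex-disjoint wall paths in T_i starts at its own vertex of
-- the left wall, so the paths inject into the left wall and k ≤ k_i.
module Submission where

open import Defs
open import Data.Nat using (ℕ; _≤_; zero; suc)
open import Data.Nat.Properties using (⊓-glb)
open import Data.Fin using (Fin; zero; suc)
open import Data.Fin.Properties using (injective⇒≤)
open import Data.Product using (Σ; _,_)
open import Data.List using (List)
open import Data.List.Membership.Propositional using (_∈_)
open import Data.List.Relation.Unary.Any using (here)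
open import Relation.Binary.PropositionalEquality using (_≡_; refl; sym; subst)

≤-minFin : ∀ m (f : Fin (suc m) → ℕ) {k} → (∀ i → k ≤ f i) → k ≤ minFin m f
≤-minFin zero    f k≤f = k≤f zero
≤-minFin (suc m) f k≤f = ⊓-glb (k≤f zero) (≤-minFin m (λ i → f (suc i)) (λ i → k≤f (suc i)))

module _ {p q r : ℕ} {R : TV p q r → TV p q r → Set} where

  wallPath-start : ∀ {P} → IsWallPath R P → Fin p
  wallPath-start (a , _) = a

  wallPath-start∈ : ∀ {P} (isPath : IsWallPath R P) → leftW (wallPath-start isPath) ∈ P
  wallPath-start∈ (_ , _ , _ , refl , _) = here refl

  disjointWallPaths⇒≤leftWall : ∀ {k} (P : Fin k → List (TV p q r)) →
    (isPath : ∀ j → IsWallPath R (P j)) →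
    (∀ j j′ v → v ∈ P j → v ∈ P j′ → j ≡ j′) →
    k ≤ p
  disjointWallPaths⇒≤leftWall {k} P isPath disjoint = injective⇒≤ {f = start} start-injective
    where
    start : Fin k → Fin p
    start j = wallPath-start (isPath j)

    start-injective : ∀ {j j′} → start j ≡ start j′ → j ≡ j′
    start-injective {j} {j′} eq = disjoint j j′ (leftW (start j)) (wallPath-start∈ (isPath j))
      (subst (λ a → leftW a ∈ P j′) (sym eq) (wallPath-start∈ (isPath j′)))

traversing⇒≤leftWall : ∀ G {k} (C : HamCycle G) → Traversing G k C → ∀ i → k ≤ kk G i
traversing⇒≤leftWall G C traversing i with traversing i
... | P , isPath , disjoint , _ = disjointWallPaths⇒≤leftWall {R = TileEdge G C i} P isPath disjoint

corollary1 : (G : TiledGraph) (k : ℕ) →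
    Σ (HamCycle G) (λ C → Traversing G k C) → k ≤ minws G
corollary1 G k (C , traversing) = ≤-minFin (m G) (kk G) (traversing⇒≤leftWall G C traversing)
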